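{- Let $\kappa$ be a regular cardinal, $(G,i)$ a $\kappa$-filter pair over a signature $\Sigma$ and $X$ a set. Then for every $\Sigma$-algebra $M$ and every $a\in G(M)$, the set $i_M(a)\subseteq M$ is a filter of the logic $Log_X(G,i)$.
   Context: A $\kappa$-filter pair over $\Sigma$ is a pair $(G,i)$ with $G$ a contravariant functor from $\Sigma$-algebras to $\kappa$-presentable lattices (complete lattices in which every element is a supremum of $\kappa$-small elements; $x$ is $\kappa$-small if $x\le\sup D$ for $\kappa$-directed $D$ implies $x\le d$ for some $d\in D$; $D$ is $\kappa$-directed if each subset of size $<\kappa$ has an upper bound in $D$), and order preserving maps $i_M\colon G(M)\to\wp(M)$ preserving arbitrary infima and $\kappa$-directed suprema with $i_M\circ G(h)=h^{ -1}\circ i_N$ for each homomorphism $h\colon M\to N$. $Log_X(G,i)$ is the relation on the absolutely free algebra $Fm_\Sigma(X)$ with $\Gamma\vdash\varphi$ iff $\varphi\in i_{Fm_\Sigma(X)}(b)$ for every $b\in G(Fm_\Sigma(X))$ with $\Gamma\subseteq i_{Fm_\Sigma(X)}(b)$. A filter of this logic on $M$ is $F\subseteq M$ such that $\Gamma\vdash\varphi$ and a homomorphism $\sigma\colon Fm_\Sigma(X)\to M$ with $\sigma(\Gamma)\subseteq F$ imply $\sigma(\varphi)\in F$. -}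

module Defs where

open import Level using (0ℓ)
open import Data.Nat using (ℕ)
open import Data.Fin using (Fin)
open import Data.Product using (Σ; ∃; _×_; _,_)
open import Data.Empty using (⊥)
open import Relation.Nullary using (¬_)
open import Relation.Unary using (Pred; _⊆_; _∈_)
open import Relation.Binary.PropositionalEquality using (_≡_)
open import Relation.Binary.Structures using (IsPartialOrder)
open import Function.Bundles using (_↣_; _⇔_)

-- Cardinals.  A cardinal κ is represented by a type K of cardinality κ.
-- A type I has size < κ iff I injects into K but K does not inject into I.

SizeLt : Set → Set → Set
SizeLt K I = (I ↣ K) × ¬ (K ↣ I)

record Regular (K : Set) : Set₁ where
  field
    infinite : ℕ ↣ K
    regular  : (I : Set) (J : I → Set) → SizeLt K I →
               ((x : I) → SizeLt K (J x)) → SizeLt K (Σ I J)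

SmallSubset : {A : Set} → Set → Pred A 0ℓ → Set
SmallSubset {A} K S = SizeLt K (Σ A S)

record Signature : Set₁ where
  field
    Op    : Set
    arity : Op → ℕ

module _ (Sig : Signature) where
  open Signature Sig

  record Algebra : Set₁ where
    field
      Carrier : Set
      ⟦_⟧     : (f : Op) → (Fin (arity f) → Carrier) → Carrier

  open Algebra

  record Hom (M N : Algebra) : Set where
    field
      fun  : Carrier M → Carrier N
      pres : (f : Op) (xs : Fin (arity f) → Carrier M) →
             fun (⟦ M ⟧ f xs) ≡ ⟦ N ⟧ f (λ k → fun (xs k))

  open Hom

  idHom : (M : Algebra) → Hom M M
  fun  (idHom M) x = x
  pres (idHom M) f xs = _≡_.refl

  _∘H_ : {L M N : Algebra} → Hom M N → Hom L M → Hom L N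
  fun (_∘H_ g h) x = fun g (fun h x)
  pres (_∘H_ {L} {M} {N} g h) f xs
    rewrite pres h f xs = pres g f (λ k → fun h (xs k))

  data Term (X : Set) : Set where
    var : X → Term X
    app : (f : Op) → (Fin (arity f) → Term X) → Term X

  Fm : Set → Algebra
  Carrier (Fm X) = Term X
  ⟦ Fm X ⟧ = app

record CompleteLattice : Set₁ where
  field
    Carrier        : Set
    _≤_            : Carrier → Carrier → Set
    isPartialOrder : IsPartialOrder _≡_ _≤_
    ⋁              : Pred Carrier 0ℓ → Carrier
    ⋁-upper        : (S : Pred Carrier 0ℓ) (x : Carrier) → x ∈ S → x ≤ ⋁ S
    ⋁-least        : (S : Pred Carrier 0ℓ) (u : Carrier) →
                     ((x : Carrier) → x ∈ S → x ≤ u) → ⋁ S ≤ u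
    ⋀              : Pred Carrier 0ℓ → Carrier
    ⋀-lower        : (S : Pred Carrier 0ℓ) (x : Carrier) → x ∈ S → ⋀ S ≤ x
    ⋀-greatest     : (S : Pred Carrier 0ℓ) (l : Carrier) →
                     ((x : Carrier) → x ∈ S → l ≤ x) → l ≤ ⋀ S

module _ (K : Set) (L : CompleteLattice) where
  open CompleteLattice L

  IsDirected : Pred Carrier 0ℓ → Set₁
  IsDirected D = (S : Pred Carrier 0ℓ) → S ⊆ D → SmallSubset K S →
                 ∃ λ d → d ∈ D × ((x : Carrier) → x ∈ S → x ≤ d)

  IsSmall : Carrier → Set₁
  IsSmall x = (D : Pred Carrier 0ℓ) → IsDirected D → x ≤ ⋁ D →
              ∃ λ d → d ∈ D × x ≤ d

  IsPresentable : Set₁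
  IsPresentable = (x : Carrier) →
    ∃ λ (S : Pred Carrier 0ℓ) → ((y : Carrier) → y ∈ S → IsSmall y) × x ≡ ⋁ S

record PresentableLattice (K : Set) : Set₂ where
  field
    lattice       : CompleteLattice
    isPresentable : IsPresentable K lattice
  open CompleteLattice lattice public

Image : {A B : Set} → (A → B) → Pred A 0ℓ → Pred B 0ℓ
Image f S y = ∃ λ x → x ∈ S × f x ≡ y

record LatMap (K : Set) (L₁ L₂ : PresentableLattice K) : Set₁ where
  private
    module A = PresentableLattice L₁
    module B = PresentableLattice L₂
  field
    fun        : A.Carrier → B.Carrier
    monotone   : (x y : A.Carrier) → x A.≤ y → fun x B.≤ fun y
    pres-⋀     : (S : Pred A.Carrier 0ℓ) → fun (A.⋀ S) ≡ B.⋀ (Image fun S)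
    pres-⋁-dir : (D : Pred A.Carrier 0ℓ) → IsDirected K A.lattice D →
                 fun (A.⋁ D) ≡ B.⋁ (Image fun D)

record FilterPair (Sig : Signature) (K : Set) : Set₂ where
  private
    Alg = Algebra Sig
    H   = Hom Sig
  open Algebra
  field
    G₀     : Alg → PresentableLattice K
    G₁     : {M N : Alg} → H M N → LatMap K (G₀ N) (G₀ M)
    G-id   : (M : Alg) (x : PresentableLattice.Carrier (G₀ M)) →
             LatMap.fun (G₁ (idHom Sig M)) x ≡ x
    G-comp : {L M N : Alg} (g : H M N) (h : H L M)
             (x : PresentableLattice.Carrier (G₀ N)) →
             LatMap.fun (G₁ (_∘H_ Sig g h)) x
               ≡ LatMap.fun (G₁ h) (LatMap.fun (G₁ g) x)
    i          : (M : Alg) → PresentableLattice.Carrier (G₀ M) → Pred (Carrier M) 0ℓ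
    i-monotone : (M : Alg) (a b : PresentableLattice.Carrier (G₀ M)) →
                 PresentableLattice._≤_ (G₀ M) a b → i M a ⊆ i M b
    i-pres-⋀   : (M : Alg) (S : Pred (PresentableLattice.Carrier (G₀ M)) 0ℓ)
                 (m : Carrier M) →
                 (m ∈ i M (PresentableLattice.⋀ (G₀ M) S))
                   ⇔ ((a : PresentableLattice.Carrier (G₀ M)) → a ∈ S → m ∈ i M a)
    i-pres-⋁   : (M : Alg) (D : Pred (PresentableLattice.Carrier (G₀ M)) 0ℓ) →
                 IsDirected K (PresentableLattice.lattice (G₀ M)) D →
                 (m : Carrier M) →
                 (m ∈ i M (PresentableLattice.⋁ (G₀ M) D))
                   ⇔ (∃ λ a → a ∈ D × m ∈ i M a)
    i-natural  : {M N : Alg} (h : H M N) (b : PresentableLattice.Carrier (G₀ N))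
                 (m : Carrier M) →
                 (m ∈ i M (LatMap.fun (G₁ h) b)) ⇔ (Hom.fun h m ∈ i N b)

module _ {Sig : Signature} {K : Set} (FP : FilterPair Sig K) (X : Set) where
  open FilterPair FP

  LogX : Pred (Term Sig X) 0ℓ → Term Sig X → Set
  LogX Γ φ = (b : PresentableLattice.Carrier (G₀ (Fm Sig X))) →
             Γ ⊆ i (Fm Sig X) b → φ ∈ i (Fm Sig X) b

  IsFilter : (M : Algebra Sig) → Pred (Algebra.Carrier M) 0ℓ → Set₁
  IsFilter M F = (Γ : Pred (Term Sig X) 0ℓ) (φ : Term Sig X) → LogX Γ φ →
                 (σ : Hom Sig (Fm Sig X) M) →
                 ((γ : Term Sig X) → γ ∈ Γ → Hom.fun σ γ ∈ F) →
                 Hom.fun σ φ ∈ F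

{-# OPTIONS --safe #-}
module Submission where

open import Defs
open import Function.Bundles using (Equivalence)
open import Relation.Unary using (_⊆_)

-- The preimage σ⁻¹(i_M(a)) is the theory i(G(σ)(a)) of Fm(X), and every
-- theory of that form is closed under Log_X(G,i) by definition.
lemma4p2 : (Sig : Signature) (K : Set) → Regular K → (FP : FilterPair Sig K) (X : Set)
    (M : Algebra Sig) (a : PresentableLattice.Carrier (FilterPair.G₀ FP M)) →
    IsFilter FP X M (FilterPair.i FP M a)
lemma4p2 Sig K _ FP X M a Γ φ Γ⊢φ σ σΓ⊆ia =
  to (i-natural σ a φ) (Γ⊢φ (LatMap.fun (G₁ σ) a) Γ⊆pullback)
  where
  open FilterPair FP
  open Equivalence

  Γ⊆pullback : Γ ⊆ i (Fm Sig X) (LatMap.fun (G₁ σ) a)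
  Γ⊆pullback {γ} γ∈Γ = from (i-natural σ a γ) (σΓ⊆ia γ γ∈Γ)
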